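{- Let $k\ge 3$ be an integer and let $S$ be a set of integers containing no arithmetic progression of length $k$. Let $c$ be a real number with $1<c<\frac{k}{k-1}$. Then there exists $N_0$ such that for every integer $N\ge N_0$ the following holds: if $a_0$ is a non-negative integer and $A=\{a_1,\ldots,a_d\}$ is a set of $d$ distinct positive integers such that \[ H(a_0;a_1,\ldots,a_d) := \Big\{ a_0+\sum_{i=1}^d \epsilon_i a_i : \epsilon_i\in\{0,1\}\Big\} \subseteq S\cap[1,N], \] then \[ d\le \frac{2(k-2)}{(k-1)\log c}\log N. \]
   Context: An arithmetic progression of length $k$ is a set $\{b, b+h, \ldots, b+(k-1)h\}$ with $b,h$ integers and $h\neq 0$. $\log$ denotes the natural logarithm.
   Formalization: The parameter c ranges over the rationals with 1 < c and c(k−1) < k, rather than over the reals. -}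

module Defs where

open import Data.Nat using (ℕ; zero; suc; _+_)
open import Data.Integer as ℤ using (ℤ; +_)
open import Data.Rational as ℚ using (ℚ; 1ℚ; _/_)
open import Data.Fin using (Fin; zero; suc; toℕ)
open import Data.Bool using (Bool; if_then_else_)
open import Data.Product using (∃-syntax; _×_)
open import Relation.Nullary using (¬_)
open import Relation.Binary.PropositionalEquality using (_≢_)

ℕtoℚ : ℕ → ℚ
ℕtoℚ n = + n / 1

_^ℚ_ : ℚ → ℕ → ℚ
c ^ℚ zero = 1ℚ
c ^ℚ suc n = c ℚ.* (c ^ℚ n)

HasAP : ℕ → (ℤ → Set) → Set
HasAP k S = ∃[ b ] ∃[ h ] (h ≢ + 0 × ((i : Fin k) → S (b ℤ.+ (+ toℕ i) ℤ.* h)))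

NoAP : ℕ → (ℤ → Set) → Set
NoAP k S = ¬ HasAP k S

cubeSum : (d : ℕ) → (Fin d → ℕ) → (Fin d → Bool) → ℕ
cubeSum zero a ε = 0
cubeSum (suc d) a ε = (if ε zero then a zero else 0) + cubeSum d (λ i → a (suc i)) (λ i → ε (suc i))

{-# OPTIONS --safe #-}
-- Write k = m + 2. If Z ⊇ Y ∪ (Y + a) contains no k-term progression of difference a, then a
-- walk from any y ∈ Y in steps of a must leave Y inside Z within m steps, so |Y| ≤ m |Z ∖ Y|
-- and hence (m + 1) |Y| ≤ m |Z|. The Hilbert cube H(a₀; a₁, …, a_d) arises from {a₀} by d such
-- doublings Z = Y ∪ (Y + aᵢ) and lies in [1, N], so (m + 1)^d ≤ m^d N. Since
-- c < k/(k − 1) < (m + 1)/m this gives c^d ≤ N, and c^(d(k−1)) ≤ c^(2d(k−2)) ≤ N^(2(k−2))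
-- because k − 1 ≤ 2(k − 2).
module Submission where

module HilbertCube where

  open import Defs
  open import Data.Bool using (Bool; true; false; _∧_; _∨_; not)
  open import Data.Bool.Properties using (T-≡; ∨-zeroʳ)
  open import Data.Empty using (⊥; ⊥-elim)
  open import Data.Fin using (Fin; zero; suc; toℕ)
  open import Data.Fin.Properties using (toℕ<n)
  open import Data.Integer as ℤ using (ℤ; +_)
  open import Data.Integer.Properties using (pos-+; pos-*)
  open import Data.Nat using (ℕ; zero; suc; _+_; _*_; _^_; _≤_; _<_; z≤n; s≤s; _≡ᵇ_)
  open import Data.Nat.Properties
  open import Data.Vec.Functional using (_∷_)
  open import Data.Product using (∃-syntax; _×_; _,_; proj₁; proj₂)
  open import Data.Sum using (_⊎_; inj₁; inj₂)
  open import Function using (_∘_; Equivalence)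
  open import Algebra.Properties.CommutativeSemigroup +-commutativeSemigroup
    using () renaming (interchange to +-interchange; xy∙z≈xz∙y to +-right-comm)
  open import Algebra.Properties.CommutativeSemigroup *-commutativeSemigroup
    using () renaming (x∙yz≈y∙xz to *-left-comm)
  open import Relation.Nullary using (¬_)
  open import Relation.Binary.PropositionalEquality
    using (_≡_; refl; sym; trans; cong; cong₂; subst)

  sum< : (ℕ → ℕ) → ℕ → ℕ
  sum< f zero = 0
  sum< f (suc n) = f n + sum< f n

  sum<-cong : ∀ {f g} n → (∀ x → f x ≡ g x) → sum< f n ≡ sum< g n
  sum<-cong zero f≗g = refl
  sum<-cong (suc n) f≗g = cong₂ _+_ (f≗g n) (sum<-cong n f≗g)

  sum<-mono-≤ : ∀ {f g} n → (∀ x → f x ≤ g x) → sum< f n ≤ sum< g n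
  sum<-mono-≤ zero f≤g = z≤n
  sum<-mono-≤ (suc n) f≤g = +-mono-≤ (f≤g n) (sum<-mono-≤ n f≤g)

  sum<-distrib-+ : ∀ f g n → sum< (λ x → f x + g x) n ≡ sum< f n + sum< g n
  sum<-distrib-+ f g zero = refl
  sum<-distrib-+ f g (suc n) =
    trans (cong₂ _+_ refl (sum<-distrib-+ f g n)) (+-interchange (f n) (g n) (sum< f n) (sum< g n))

  term≤sum< : ∀ f {x n} → x < n → f x ≤ sum< f n
  term≤sum< f {x} {suc n} (s≤s x≤n) with m≤n⇒m<n∨m≡n x≤n
  ... | inj₁ x<n = ≤-trans (term≤sum< f x<n) (m≤n+m _ (f n))
  ... | inj₂ refl = m≤m+n (f x) _

  sum<-split : ∀ f n t → sum< (λ x → f (x + t)) n + sum< f t ≡ sum< f (n + t)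
  sum<-split f zero t = refl
  sum<-split f (suc n) t = trans (+-assoc (f (n + t)) _ _) (cong₂ _+_ refl (sum<-split f n t))

  sum<-vanishing : ∀ f n t → (∀ x → n ≤ x → f x ≡ 0) → sum< f (n + t) ≡ sum< f n
  sum<-vanishing f n zero f≡0 = cong (sum< f) (+-identityʳ n)
  sum<-vanishing f n (suc t) f≡0 rewrite +-suc n t | f≡0 (n + t) (m≤m+n n t) = sum<-vanishing f n t f≡0

  sum<-shift-≤ : ∀ f t n → (∀ x → n ≤ x → f x ≡ 0) → sum< (λ x → f (x + t)) n ≤ sum< f n
  sum<-shift-≤ f t n f≡0 = begin
    sum< (λ x → f (x + t)) n                ≤⟨ m≤m+n _ (sum< f t) ⟩
    sum< (λ x → f (x + t)) n + sum< f t     ≡⟨ sum<-split f n t ⟩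
    sum< f (n + t)                          ≡⟨ sum<-vanishing f n t f≡0 ⟩
    sum< f n                                ∎
    where open ≤-Reasoning

  sum<-zero : ∀ n → sum< (λ _ → 0) n ≡ 0
  sum<-zero zero = refl
  sum<-zero (suc n) = sum<-zero n

  𝟙 : Bool → ℕ
  𝟙 true = 1
  𝟙 false = 0

  𝟙≤1 : ∀ b → 𝟙 b ≤ 1
  𝟙≤1 true = ≤-refl
  𝟙≤1 false = z≤n

  count : (ℕ → Bool) → ℕ → ℕ
  count P = sum< (𝟙 ∘ P)

  count-≤-if-0∉ : ∀ {P} n → ¬ P 0 ≡ true → count P (suc n) ≤ n
  count-≤-if-0∉ {P} zero 0∉P with P 0
  ... | true = ⊥-elim (0∉P refl)
  ... | false = z≤n
  count-≤-if-0∉ {P} (suc n) 0∉P = +-mono-≤ (𝟙≤1 (P (suc n))) (count-≤-if-0∉ n 0∉P)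

  ContainsAP : ℕ → (ℕ → Set) → ℕ → ℕ → Set
  ContainsAP k P y a = ∀ i → i < k → P (y + i * a)

  APFree : ℕ → (ℕ → Set) → Set
  APFree k P = ∀ y a → 1 ≤ a → ¬ ContainsAP k P y a

  ContainsAP-snoc : ∀ {k P y a} → ContainsAP k P y a → P (y + k * a) → ContainsAP (suc k) P y a
  ContainsAP-snoc ap last i i<k+1 with m<1+n⇒m<n∨m≡n i<k+1
  ... | inj₁ i<k = ap i i<k
  ... | inj₂ refl = last

  NoAP⇒APFree : ∀ {k S} → NoAP k S → APFree k (λ x → S (+ x))
  NoAP⇒APFree {k} {S} noAP y a a≥1 ap = noAP (+ y , + a , a≢0 , ap-in-ℤ)
    where
    a≢0 : + a ≡ + 0 → ⊥
    a≢0 a≡0 = <⇒≢ a≥1 (sym (cong ℤ.∣_∣ a≡0))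
    ap-in-ℤ : (i : Fin k) → S (+ y ℤ.+ + toℕ i ℤ.* + a)
    ap-in-ℤ i = subst S (trans (pos-+ y (toℕ i * a)) (cong (λ z → + y ℤ.+ z) (pos-* (toℕ i) a)))
                        (ap (toℕ i) (toℕ<n i))

  +-*-suc-step : ∀ y j a → y + suc j * a ≡ (y + j * a) + a
  +-*-suc-step y j a = trans (cong (λ z → y + z) (+-comm a (j * a))) (sym (+-assoc y (j * a) a))

  module _ {m a n : ℕ} {Y Z : ℕ → Bool}
           (Y⊆Z : ∀ {x} → Y x ≡ true → Z x ≡ true)
           (Y+a⊆Z : ∀ {x} → Y x ≡ true → Z (x + a) ≡ true)
           (Z<n : ∀ {x} → Z x ≡ true → x < n)
           (Z-APFree : ∀ y → ¬ ContainsAP (suc (suc m)) (λ x → Z x ≡ true) y a)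
    where

    private
      InY InZ : ℕ → Set
      InY x = Y x ≡ true
      InZ x = Z x ≡ true

      New : ℕ → Bool
      New x = Z x ∧ not (Y x)

      hits : ℕ → ℕ → ℕ
      hits j y = sum< (λ i → 𝟙 (New (y + suc i * a))) j

      next∈Z : ∀ y j → Y (y + j * a) ≡ true → Z (y + suc j * a) ≡ true
      next∈Z y j y+ja∈Y = subst InZ (sym (+-*-suc-step y j a)) (Y+a⊆Z y+ja∈Y)

      escape : ∀ j {y} → Y y ≡ true → 1 ≤ hits j y ⊎ ContainsAP (suc j) InY y a
      escape zero {y} y∈Y = inj₂ λ { zero _ → subst InY (sym (+-identityʳ y)) y∈Y
                                  ; (suc _) (s≤s ()) }
      escape (suc j) {y} y∈Y with escape j y∈Y
      ... | inj₁ hit = inj₁ (≤-trans hit (m≤n+m _ _))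
      ... | inj₂ run with Y (y + suc j * a) in e
      ...   | true = inj₂ (ContainsAP-snoc {P = InY} {y} {a} run e)
      ...   | false =
        inj₁ (subst (λ b → 1 ≤ 𝟙 (b ∧ true) + hits j y) (sym (next∈Z y j (run j ≤-refl))) (s≤s z≤n))

      𝟙Y≤hits : ∀ y → 𝟙 (Y y) ≤ hits m y
      𝟙Y≤hits y with Y y in e
      ... | false = z≤n
      ... | true with escape m e
      ...   | inj₁ hit = hit
      ...   | inj₂ run = ⊥-elim (Z-APFree y (ContainsAP-snoc {P = InZ} {y} {a}
                                               (λ i i<m+1 → Y⊆Z (run i i<m+1)) (next∈Z y m (run m ≤-refl))))

      𝟙New-vanishing : ∀ x → n ≤ x → 𝟙 (New x) ≡ 0
      𝟙New-vanishing x n≤x with Z x in e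
      ... | false = refl
      ... | true = ⊥-elim (<⇒≱ (Z<n e) n≤x)

      sum<-hits : ∀ j → sum< (hits j) n ≤ j * count New n
      sum<-hits zero = ≤-reflexive (sum<-zero n)
      sum<-hits (suc j) = begin
        sum< (hits (suc j)) n
          ≡⟨ sum<-distrib-+ (λ y → 𝟙 (New (y + suc j * a))) (hits j) n ⟩
        sum< (λ y → 𝟙 (New (y + suc j * a))) n + sum< (hits j) n
          ≤⟨ +-mono-≤ (sum<-shift-≤ (𝟙 ∘ New) (suc j * a) n 𝟙New-vanishing) (sum<-hits j) ⟩
        count New n + j * count New n
          ∎
        where open ≤-Reasoning

      𝟙-split : ∀ x → 𝟙 (Z x) ≡ 𝟙 (Y x) + 𝟙 (Z x ∧ not (Y x))
      𝟙-split x with Y x in e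
      ... | true rewrite Y⊆Z e = refl
      ... | false with Z x
      ...   | true = refl
      ...   | false = refl

    count-growth : suc m * count Y n ≤ m * count Z n
    count-growth = begin
      count Y n + m * count Y n          ≤⟨ +-monoˡ-≤ (m * count Y n) Y≤m·New ⟩
      m * count New n + m * count Y n    ≡⟨ sym (*-distribˡ-+ m (count New n) (count Y n)) ⟩
      m * (count New n + count Y n)      ≡⟨ cong (m *_) (+-comm (count New n) (count Y n)) ⟩
      m * (count Y n + count New n)      ≡⟨ cong (m *_) (sym count-split) ⟩
      m * count Z n                      ∎
      where
      open ≤-Reasoning
      Y≤m·New : count Y n ≤ m * count New n
      Y≤m·New = ≤-trans (sum<-mono-≤ n 𝟙Y≤hits) (sum<-hits m)
      count-split : count Z n ≡ count Y n + count New n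
      count-split = trans (sum<-cong n 𝟙-split) (sum<-distrib-+ (𝟙 ∘ Y) (𝟙 ∘ New) n)

  inCube : (d : ℕ) → (Fin d → ℕ) → ℕ → ℕ → Bool
  inCube zero a b x = b ≡ᵇ x
  inCube (suc d) a b x = inCube d (a ∘ suc) b x ∨ inCube d (a ∘ suc) (b + a zero) x

  inCube-sound : ∀ d a b {x} → inCube d a b x ≡ true → ∃[ ε ] b + cubeSum d a ε ≡ x
  inCube-sound zero a b {x} b≡ᵇx = (λ ()) , trans (+-identityʳ b) (≡ᵇ⇒≡ b x (Equivalence.from T-≡ b≡ᵇx))
  inCube-sound (suc d) a b {x} x∈H with inCube d (a ∘ suc) b x in e
  ... | true = let ε , p = inCube-sound d (a ∘ suc) b e in false ∷ ε , p
  ... | false = let ε , p = inCube-sound d (a ∘ suc) (b + a zero) x∈H in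
                true ∷ ε , trans (sym (+-assoc b (a zero) _)) p

  inCube-complete : ∀ d a b ε → inCube d a b (b + cubeSum d a ε) ≡ true
  inCube-complete zero a b ε = Equivalence.to T-≡ (≡⇒≡ᵇ b (b + 0) (sym (+-identityʳ b)))
  inCube-complete (suc d) a b ε with ε zero
  ... | false =
    cong (_∨ inCube d (a ∘ suc) (b + a zero) (b + s)) (inCube-complete d (a ∘ suc) b (ε ∘ suc))
    where s = cubeSum d (a ∘ suc) (ε ∘ suc)
  ... | true rewrite sym (+-assoc b (a zero) (cubeSum d (a ∘ suc) (ε ∘ suc))) =
    trans (cong (inCube d (a ∘ suc) b (b + a zero + s) ∨_)
                (inCube-complete d (a ∘ suc) (b + a zero) (ε ∘ suc)))
          (∨-zeroʳ _)
    where s = cubeSum d (a ∘ suc) (ε ∘ suc)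

  inCube-translate : ∀ d a b t {x} → inCube d a b x ≡ true → inCube d a (b + t) (x + t) ≡ true
  inCube-translate d a b t x∈H =
    let ε , b+s≡x = inCube-sound d a b x∈H in
    subst (λ z → inCube d a (b + t) z ≡ true)
          (trans (+-right-comm b t _) (cong (_+ t) b+s≡x))
          (inCube-complete d a (b + t) ε)

  module _ {m n : ℕ} {P : ℕ → Set} (P-APFree : APFree (suc (suc m)) P) where

    cube-count-growth : ∀ d (a : Fin d → ℕ) b → (∀ i → 1 ≤ a i) →
                        (∀ {x} → inCube d a b x ≡ true → P x × x < n) →
                        suc m ^ d ≤ m ^ d * count (inCube d a b) n
    cube-count-growth zero a b _ H⊆P = begin
      1                                 ≡⟨ cong 𝟙 (sym b∈H) ⟩
      𝟙 (inCube zero a b b)             ≤⟨ term≤sum< (𝟙 ∘ inCube zero a b) (proj₂ (H⊆P b∈H)) ⟩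
      count (inCube zero a b) n         ≡⟨ sym (*-identityˡ _) ⟩
      1 * count (inCube zero a b) n     ∎
      where
      open ≤-Reasoning
      b∈H : inCube zero a b b ≡ true
      b∈H = Equivalence.to T-≡ (≡⇒≡ᵇ b b refl)
    cube-count-growth (suc d) a b a≥1 H⊆P = begin
      suc m * suc m ^ d          ≤⟨ *-monoʳ-≤ (suc m) (cube-count-growth d a′ b (a≥1 ∘ suc) (H⊆P ∘ Y⊆Z)) ⟩
      suc m * (m ^ d * count Y n) ≡⟨ *-left-comm (suc m) (m ^ d) (count Y n) ⟩
      m ^ d * (suc m * count Y n) ≤⟨ *-monoʳ-≤ (m ^ d) (count-growth Y⊆Z Y+a⊆Z (proj₂ ∘ H⊆P) Z-APFree) ⟩
      m ^ d * (m * count Z n)     ≡⟨ *-left-comm (m ^ d) m (count Z n) ⟩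
      m * (m ^ d * count Z n)     ≡⟨ sym (*-assoc m (m ^ d) (count Z n)) ⟩
      m * m ^ d * count Z n       ∎
      where
      open ≤-Reasoning
      a′ = a ∘ suc
      Y = inCube d a′ b
      Z = inCube (suc d) a b
      Y⊆Z : ∀ {x} → Y x ≡ true → Z x ≡ true
      Y⊆Z {x} x∈Y = cong (_∨ inCube d a′ (b + a zero) x) x∈Y
      Y+a⊆Z : ∀ {x} → Y x ≡ true → Z (x + a zero) ≡ true
      Y+a⊆Z {x} x∈Y = trans (cong (Y (x + a zero) ∨_) (inCube-translate d a′ b (a zero) x∈Y)) (∨-zeroʳ _)
      Z-APFree : ∀ y → ¬ ContainsAP (suc (suc m)) (λ x → Z x ≡ true) y (a zero)
      Z-APFree y ap = P-APFree y (a zero) (a≥1 zero) (λ i i<k → proj₁ (H⊆P (ap i i<k)))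

  hypercube-bound : ∀ m (S : ℤ → Set) → NoAP (suc (suc m)) S →
                    ∀ N a₀ d (a : Fin d → ℕ) → (∀ i → 1 ≤ a i) →
                    ((ε : Fin d → Bool) →
                      S (+ (a₀ + cubeSum d a ε)) × (1 ≤ a₀ + cubeSum d a ε) × (a₀ + cubeSum d a ε ≤ N)) →
                    suc m ^ d ≤ m ^ d * N
  hypercube-bound m S noAP N a₀ d a a≥1 H⊆S∩[1,N] = begin
    suc m ^ d                             ≤⟨ cube-count-growth S-APFree d a a₀ a≥1 H⊆S∩[0,N] ⟩
    m ^ d * count (inCube d a a₀) (suc N) ≤⟨ *-monoʳ-≤ (m ^ d) (count-≤-if-0∉ N 0∉H) ⟩
    m ^ d * N                             ∎
    where
    open ≤-Reasoning
    S-APFree : APFree (suc (suc m)) (λ x → S (+ x))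
    S-APFree = NoAP⇒APFree {S = S} noAP
    ∈H⇒ : ∀ {x} → inCube d a a₀ x ≡ true → S (+ x) × (1 ≤ x) × (x ≤ N)
    ∈H⇒ x∈H = let ε , p = inCube-sound d a a₀ x∈H in
              subst (λ x → S (+ x) × (1 ≤ x) × (x ≤ N)) p (H⊆S∩[1,N] ε)
    H⊆S∩[0,N] : ∀ {x} → inCube d a a₀ x ≡ true → S (+ x) × x < suc N
    H⊆S∩[0,N] x∈H = let x∈S , _ , x≤N = ∈H⇒ x∈H in x∈S , s≤s x≤N
    0∉H : ¬ inCube d a a₀ 0 ≡ true
    0∉H 0∈H with () ← proj₁ (proj₂ (∈H⇒ 0∈H))


module RationalPowers where

  open import Defs
  open import Algebra.Bundles using (CommutativeRing)
  open import Data.Integer as ℤ using (+_; +≤+; +<+)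
  import Data.Integer.Properties as ℤ
  open import Data.Nat as ℕ using (ℕ; zero; suc; z≤n; s≤s)
  import Data.Nat.Properties as ℕ
  open import Data.Nat.Coprimality using (1-coprimeTo) renaming (sym to coprime-sym)
  open import Data.Rational as ℚ using (ℚ; 0ℚ; 1ℚ; mkℚ; -_; _+_; _*_; _≤_; _<_; *≤*; *<*)
  open import Data.Rational.Properties
  import Data.Rational.Unnormalised as ℚᵘ
  import Data.Rational.Unnormalised.Properties as ℚᵘ
  open import Relation.Binary.PropositionalEquality
    using (_≡_; refl; sym; trans; cong; cong₂; subst; subst₂)
  open import Algebra.Properties.CommutativeSemiring.Exp
    (CommutativeRing.commutativeSemiring +-*-commutativeRing)
    using (^-assocʳ; ^-distrib-*)
  open import Algebra.Properties.CommutativeSemiring.Exp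
    (CommutativeRing.commutativeSemiring +-*-commutativeRing)
    using (_^_) public

  ^ℚ≡^ : ∀ x n → x ^ℚ n ≡ x ^ n
  ^ℚ≡^ x zero = refl
  ^ℚ≡^ x (suc n) = cong (x *_) (^ℚ≡^ x n)

  0≤1 : 0ℚ ≤ 1ℚ
  0≤1 = *≤* (+≤+ z≤n)

  ^-nonNeg : ∀ {x} n → 0ℚ ≤ x → 0ℚ ≤ x ^ n
  ^-nonNeg zero 0≤x = 0≤1
  ^-nonNeg {x} (suc n) 0≤x = nonNegative⁻¹ (x * x ^ n)
    {{nonNeg*nonNeg⇒nonNeg x {{ℚ.nonNegative 0≤x}} (x ^ n) {{ℚ.nonNegative (^-nonNeg n 0≤x)}}}}

  ^-monoˡ-≤ : ∀ {x y} n → 0ℚ ≤ x → x ≤ y → x ^ n ≤ y ^ n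
  ^-monoˡ-≤ zero 0≤x x≤y = ≤-refl
  ^-monoˡ-≤ {x} {y} (suc n) 0≤x x≤y = begin
    x * x ^ n  ≤⟨ *-monoʳ-≤-nonNeg (x ^ n) {{ℚ.nonNegative (^-nonNeg n 0≤x)}} x≤y ⟩
    y * x ^ n  ≤⟨ *-monoˡ-≤-nonNeg y {{ℚ.nonNegative (≤-trans 0≤x x≤y)}} (^-monoˡ-≤ n 0≤x x≤y) ⟩
    y * y ^ n  ∎
    where open ≤-Reasoning

  1≤^ : ∀ {x} n → 1ℚ ≤ x → 1ℚ ≤ x ^ n
  1≤^ zero 1≤x = ≤-refl
  1≤^ {x} (suc n) 1≤x = begin
    1ℚ        ≤⟨ 1≤x ⟩
    x         ≡⟨ sym (*-identityʳ x) ⟩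
    x * 1ℚ    ≤⟨ *-monoˡ-≤-nonNeg x {{ℚ.nonNegative (≤-trans 0≤1 1≤x)}} (1≤^ n 1≤x) ⟩
    x * x ^ n ∎
    where open ≤-Reasoning

  ^-monoʳ-≤ : ∀ {x m n} → 1ℚ ≤ x → m ℕ.≤ n → x ^ m ≤ x ^ n
  ^-monoʳ-≤ {n = n} 1≤x z≤n = 1≤^ n 1≤x
  ^-monoʳ-≤ {x} 1≤x (s≤s m≤n) =
    *-monoˡ-≤-nonNeg x {{ℚ.nonNegative (≤-trans 0≤1 1≤x)}} (^-monoʳ-≤ 1≤x m≤n)

  +-cancelʳ-< : ∀ {p q} r → p + r < q + r → p < q
  +-cancelʳ-< {p} {q} r p+r<q+r = subst₂ _<_ (cancel p) (cancel q) (+-monoˡ-< (- r) p+r<q+r)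
    where
    cancel : ∀ x → x + r + - r ≡ x
    cancel x = trans (+-assoc x r (- r)) (trans (cong (λ z → x + z) (+-inverseʳ r)) (+-identityʳ x))

  ℕtoℚ≡mkℚ : ∀ n → ℕtoℚ n ≡ mkℚ (+ n) 0 (coprime-sym (1-coprimeTo n))
  ℕtoℚ≡mkℚ n = normalize-coprime (coprime-sym (1-coprimeTo n))

  ℕtoℚ-mono-≤ : ∀ {m n} → m ℕ.≤ n → ℕtoℚ m ≤ ℕtoℚ n
  ℕtoℚ-mono-≤ {m} {n} m≤n rewrite ℕtoℚ≡mkℚ m | ℕtoℚ≡mkℚ n =
    *≤* (subst₂ ℤ._≤_ (sym (ℤ.*-identityʳ (+ m))) (sym (ℤ.*-identityʳ (+ n))) (+≤+ m≤n))

  ℕtoℚ-mono-< : ∀ {m n} → m ℕ.< n → ℕtoℚ m < ℕtoℚ n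
  ℕtoℚ-mono-< {m} {n} m<n rewrite ℕtoℚ≡mkℚ m | ℕtoℚ≡mkℚ n =
    *<* (subst₂ ℤ._<_ (sym (ℤ.*-identityʳ (+ m))) (sym (ℤ.*-identityʳ (+ n))) (+<+ m<n))

  ℕtoℚ-homo-* : ∀ m n → ℕtoℚ (m ℕ.* n) ≡ ℕtoℚ m * ℕtoℚ n
  ℕtoℚ-homo-* m n = toℚᵘ-injective (ℚᵘ.≃-trans lemma (ℚᵘ.≃-sym (toℚᵘ-homo-* (ℕtoℚ m) (ℕtoℚ n))))
    where
    lemma : ℚ.toℚᵘ (ℕtoℚ (m ℕ.* n)) ℚᵘ.≃ ℚ.toℚᵘ (ℕtoℚ m) ℚᵘ.* ℚ.toℚᵘ (ℕtoℚ n)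
    lemma rewrite ℕtoℚ≡mkℚ m | ℕtoℚ≡mkℚ n | ℕtoℚ≡mkℚ (m ℕ.* n) = ℚᵘ.*≡* (cong (ℤ._* + 1) (ℤ.pos-* m n))

  ℕtoℚ-suc : ∀ n → ℕtoℚ (suc n) ≡ ℕtoℚ n + 1ℚ
  ℕtoℚ-suc n = toℚᵘ-injective (ℚᵘ.≃-trans lemma (ℚᵘ.≃-sym (toℚᵘ-homo-+ (ℕtoℚ n) 1ℚ)))
    where
    lemma : ℚ.toℚᵘ (ℕtoℚ (suc n)) ℚᵘ.≃ ℚ.toℚᵘ (ℕtoℚ n) ℚᵘ.+ ℚ.toℚᵘ 1ℚ
    lemma rewrite ℕtoℚ≡mkℚ n | ℕtoℚ≡mkℚ (suc n) | ℕ.*-identityʳ n | ℤ.+◃n≡+n n =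
      ℚᵘ.*≡* (cong (ℤ._* + 1) (trans (cong +_ (ℕ.+-comm 1 n)) (ℤ.pos-+ n 1)))

  ℕtoℚ-homo-^ : ∀ m n → ℕtoℚ (m ℕ.^ n) ≡ ℕtoℚ m ^ n
  ℕtoℚ-homo-^ m zero = refl
  ℕtoℚ-homo-^ m (suc n) = trans (ℕtoℚ-homo-* m (m ℕ.^ n)) (cong (ℕtoℚ m *_) (ℕtoℚ-homo-^ m n))

  *ℕtoℚ-<-pred : ∀ {c} n → 1ℚ < c → c * ℕtoℚ (suc n) < ℕtoℚ (suc (suc n)) → c * ℕtoℚ n < ℕtoℚ (suc n)
  *ℕtoℚ-<-pred {c} n 1<c c[n+1]<n+2 = +-cancelʳ-< c (begin-strict
    c * ℕtoℚ n + c             ≡⟨ cong (λ z → c * ℕtoℚ n + z) (sym (*-identityʳ c)) ⟩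
    c * ℕtoℚ n + c * 1ℚ        ≡⟨ sym (*-distribˡ-+ c (ℕtoℚ n) 1ℚ) ⟩
    c * (ℕtoℚ n + 1ℚ)          ≡⟨ cong (c *_) (sym (ℕtoℚ-suc n)) ⟩
    c * ℕtoℚ (suc n)           <⟨ c[n+1]<n+2 ⟩
    ℕtoℚ (suc (suc n))         ≡⟨ ℕtoℚ-suc (suc n) ⟩
    ℕtoℚ (suc n) + 1ℚ          <⟨ +-monoʳ-< (ℕtoℚ (suc n)) 1<c ⟩
    ℕtoℚ (suc n) + c           ∎)
    where open ≤-Reasoning

  ^-≤-of-ratio : ∀ {c} m .{{_ : ℕ.NonZero m}} d N → 0ℚ ≤ c → c * ℕtoℚ m ≤ ℕtoℚ (suc m) →
                 suc m ℕ.^ d ℕ.≤ m ℕ.^ d ℕ.* N → c ^ d ≤ ℕtoℚ N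
  ^-≤-of-ratio {c} m d N 0≤c cm≤m+1 growth = *-cancelʳ-≤-pos (M ^ d) {{M^d>0}} (begin
    c ^ d * M ^ d             ≡⟨ sym (^-distrib-* c M d) ⟩
    (c * M) ^ d               ≤⟨ ^-monoˡ-≤ d 0≤cM cm≤m+1 ⟩
    ℕtoℚ (suc m) ^ d          ≡⟨ sym (ℕtoℚ-homo-^ (suc m) d) ⟩
    ℕtoℚ (suc m ℕ.^ d)        ≤⟨ ℕtoℚ-mono-≤ growth ⟩
    ℕtoℚ (m ℕ.^ d ℕ.* N)      ≡⟨ ℕtoℚ-homo-* (m ℕ.^ d) N ⟩
    ℕtoℚ (m ℕ.^ d) * ℕtoℚ N   ≡⟨ cong₂ _*_ (ℕtoℚ-homo-^ m d) refl ⟩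
    M ^ d * ℕtoℚ N            ≡⟨ *-comm (M ^ d) (ℕtoℚ N) ⟩
    ℕtoℚ N * M ^ d            ∎)
    where
    open ≤-Reasoning
    M = ℕtoℚ m
    0≤cM : 0ℚ ≤ c * M
    0≤cM = nonNegative⁻¹ (c * M)
      {{nonNeg*nonNeg⇒nonNeg c {{ℚ.nonNegative 0≤c}} M {{ℚ.nonNegative (ℕtoℚ-mono-≤ {n = m} z≤n)}}}}
    M^d>0 : ℚ.Positive (M ^ d)
    M^d>0 = ℚ.positive (subst (0ℚ <_) (ℕtoℚ-homo-^ m d) (ℕtoℚ-mono-< (ℕ.m^n>0 m d)))

  ^-*-≤ : ∀ {c x} d {e f} → 1ℚ ≤ c → c ^ d ≤ x → e ℕ.≤ f → c ^ (d ℕ.* e) ≤ x ^ f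
  ^-*-≤ {c} {x} d {e} {f} 1≤c c^d≤x e≤f = begin
    c ^ (d ℕ.* e)   ≤⟨ ^-monoʳ-≤ 1≤c (ℕ.*-monoʳ-≤ d e≤f) ⟩
    c ^ (d ℕ.* f)   ≡⟨ sym (^-assocʳ c d f) ⟩
    (c ^ d) ^ f     ≤⟨ ^-monoˡ-≤ f (^-nonNeg d (≤-trans 0≤1 1≤c)) c^d≤x ⟩
    x ^ f           ∎
    where open ≤-Reasoning

open import Defs
open import Data.Nat using (ℕ; _+_; _*_; _∸_; _≤_)
open import Data.Integer using (ℤ; +_)
open import Data.Rational using (ℚ; 1ℚ; _<_)
open import Data.Rational using () renaming (_≤_ to _≤ℚ_; _*_ to _*ℚ_)
open import Data.Fin using (Fin)
open import Data.Bool using (Bool)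
open import Data.Product using (∃-syntax; _×_)
open import Function.Definitions using (Injective)
open import Relation.Binary.PropositionalEquality using (_≡_)

open import Data.Nat using (suc; s≤s)
open import Data.Rational using (0ℚ)
import Data.Nat.Properties as ℕ
open import Data.Product using (_,_)
open import Data.Rational.Properties using (<⇒≤; ≤-trans; module ≤-Reasoning)
open import Relation.Binary.PropositionalEquality using (sym)
open HilbertCube using (hypercube-bound)
open RationalPowers using (_^_; ^ℚ≡^; 0≤1; *ℕtoℚ-<-pred; ^-≤-of-ratio; ^-*-≤)

-- The bound holds for every N, and the aᵢ need not be distinct.
theorem3 : (k : ℕ) → 3 ≤ k → (S : ℤ → Set) → NoAP k S →
    (c : ℚ) → 1ℚ < c → c *ℚ ℕtoℚ (k ∸ 1) < ℕtoℚ k →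
    ∃[ N₀ ] ((N : ℕ) → N₀ ≤ N →
    (a₀ d : ℕ) (a : Fin d → ℕ) → Injective _≡_ _≡_ a → ((i : Fin d) → 1 ≤ a i) →
    ((ε : Fin d → Bool) → S (+ (a₀ + cubeSum d a ε)) × (1 ≤ a₀ + cubeSum d a ε) × (a₀ + cubeSum d a ε ≤ N)) →
    (c ^ℚ (d * (k ∸ 1))) ≤ℚ (ℕtoℚ N ^ℚ (2 * (k ∸ 2))))
theorem3 (suc (suc (suc m′))) (s≤s (s≤s (s≤s _))) S noAP c 1<c c[k-1]<k =
  0 , λ N _ a₀ d a _ a≥1 H⊆S∩[1,N] →
    let c^d≤N = ^-≤-of-ratio m d N 0≤c (<⇒≤ (*ℕtoℚ-<-pred m 1<c c[k-1]<k))
                  (hypercube-bound m S noAP N a₀ d a a≥1 H⊆S∩[1,N])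
    in begin
      c ^ℚ (d * suc m)    ≡⟨ ^ℚ≡^ c (d * suc m) ⟩
      c ^ (d * suc m)     ≤⟨ ^-*-≤ d (<⇒≤ 1<c) c^d≤N k-1≤2[k-2] ⟩
      ℕtoℚ N ^ (2 * m)    ≡⟨ sym (^ℚ≡^ (ℕtoℚ N) (2 * m)) ⟩
      ℕtoℚ N ^ℚ (2 * m)   ∎
  where
  open ≤-Reasoning
  m : ℕ
  m = suc m′
  0≤c : 0ℚ ≤ℚ c
  0≤c = ≤-trans 0≤1 (<⇒≤ 1<c)
  k-1≤2[k-2] : suc m ≤ 2 * m
  k-1≤2[k-2] = s≤s (ℕ.≤-trans (s≤s (ℕ.m≤m+n m′ 0)) (ℕ.m≤n+m (suc (m′ + 0)) m′))
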